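{- Let $k$ be a natural number and let $T$ be an extension of $\mathsf{HA}+\neg\neg\mathrm{DNE}(\Sigma_{k-1})$ ($\mathsf{HA}$ if $k=0$). If $\mathrm{PNFT}_T(\mathrm{E}_{k'},\Sigma_{k'})$ holds for all $k'\le k$, then $\mathrm{PNFT}_T(\neg\mathrm{E}_{k'},\neg\neg\Pi_{k'})$ holds for all $k'\le k$.
   Context: $\mathsf{HA}$ is intuitionistic (Heyting) arithmetic in the language with function symbols for all primitive recursive functions and logical constants $\forall,\exists,\to,\land,\lor,\perp$; $\neg\varphi$ abbreviates $\varphi\to\perp$. $S+\mathrm{P}$ adds all instances of schema $\mathrm{P}$ to $S$; an extension of $S$ is a theory in the language of $\mathsf{HA}$ proving all theorems of $S$. $\mathrm{FV}(\varphi)$ is the set of free variables. $\Sigma_0=\Pi_0$ are the quantifier-free formulas; $\Pi_{k+1}$: formulas $Q_1\bar x_1\cdots Q_{k+1}\bar x_{k+1}\varphi_{qf}$ ($Q_i=\forall$ for odd $i$, $\exists$ for even $i$); $\Sigma_{k+1}$ likewise starting with $\exists$ (blocks may be empty by the paper's convention). $\mathrm{DNE}(\Gamma)$: $\forall x(\neg\neg\varphi(x)\to\varphi(x))$ for $\varphi(x)\in\Gamma$ with free variables among $x$; $\neg\neg\mathrm{DNE}(\Gamma)$: $\neg\neg\xi$ for $\xi$ an instance (a sentence) of $\mathrm{DNE}(\Gamma)$. For a class $\Gamma$: $\neg\Gamma=\{\neg\varphi:\varphi\in\Gamma\}$, $\neg\neg\Gamma=\{\neg\neg\varphi:\varphi\in\Gamma\}$.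 $\mathrm{PNFT}_T(\Gamma,\Gamma')$: for every $\varphi\in\Gamma$ there is $\varphi'\in\Gamma'$ with $\mathrm{FV}(\varphi)=\mathrm{FV}(\varphi')$ and $T\vdash\varphi\leftrightarrow\varphi'$. Alternation paths: finite alternating sequences of $+,-$; $i(s)$ first symbol ($\times$ if empty), $s^\perp$ swaps signs, $l(s)$ length. $\mathrm{Alt}(\varphi)=\{\langle\rangle\}$ for quantifier-free $\varphi$; otherwise $\mathrm{Alt}(\neg\varphi_1)=\{s^\perp:s\in\mathrm{Alt}(\varphi_1)\}$, $\mathrm{Alt}(\varphi_1\land\varphi_2)=\mathrm{Alt}(\varphi_1\lor\varphi_2)=\mathrm{Alt}(\varphi_1)\cup\mathrm{Alt}(\varphi_2)$, $\mathrm{Alt}(\varphi_1\to\varphi_2)=\{s^\perp:s\in\mathrm{Alt}(\varphi_1)\}\cup\mathrm{Alt}(\varphi_2)$, $\mathrm{Alt}(\forall x\varphi_1)=\{s\in\mathrm{Alt}(\varphi_1):i(s)=-\}\cup\{ -s:s\in\mathrm{Alt}(\varphi_1),i(s)\ne-\}$, $\mathrm{Alt}(\exists x\varphi_1)=\{s\in\mathrm{Alt}(\varphi_1):i(s)=+\}\cup\{+s:s\in\mathrm{Alt}(\varphi_1),i(s)\ne+\}$. $\deg\varphi=\max\{l(s):s\in\mathrm{Alt}(\varphi)\}$, $\mathrm{F}_k=\{\varphi:\deg\varphi=k\}$, $\mathrm{E}_0=\mathrm{F}_0$, $\mathrm{E}_{k+1}=\{\varphi\in\mathrm{F}_{k+1}:i(s)=+$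 for all $s\in\mathrm{Alt}(\varphi)$ with $l(s)=k+1\}$. -}

module Defs where

open import Data.Nat using (ℕ; zero; suc; _⊔_)
open import Data.Fin using (Fin; zero; suc)
open import Data.Vec using (Vec; []; _∷_; tabulate)
open import Data.List using (List; []; _∷_; _++_; map; length; foldr; [_])
open import Data.List.Membership.Propositional using (_∈_)
open import Data.Maybe using (Maybe; just; nothing)
open import Data.Product using (Σ; _×_; _,_)
open import Relation.Binary.PropositionalEquality using (_≡_)

data PR : ℕ → Set where
  Z : PR 0
  S : PR 1
  P : ∀ {n} → Fin n → PR n
  C : ∀ {m n} → PR m → Vec (PR n) m → PR n
  R : ∀ {n} → PR n → PR (suc (suc n)) → PR (suc n)

-- Terms and formulas (well-scoped de Bruijn: n = number of variables in scope)

data Term (n : ℕ) : Set where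
  var : Fin n → Term n
  app : ∀ {m} → PR m → Vec (Term n) m → Term n

infix  6 _≐_
infixr 5 _∧'_ _∨'_
infixr 4 _⇒_ _⇔_

data Formula : ℕ → Set where
  _≐_  : ∀ {n} → Term n → Term n → Formula n
  ⊥'   : ∀ {n} → Formula n
  _∧'_ : ∀ {n} → Formula n → Formula n → Formula n
  _∨'_ : ∀ {n} → Formula n → Formula n → Formula n
  _⇒_  : ∀ {n} → Formula n → Formula n → Formula n
  ∀'   : ∀ {n} → Formula (suc n) → Formula n
  ∃'   : ∀ {n} → Formula (suc n) → Formula n

¬' : ∀ {n} → Formula n → Formula n
¬' φ = φ ⇒ ⊥'

_⇔_ : ∀ {n} → Formula n → Formula n → Formula n
φ ⇔ ψ = (φ ⇒ ψ) ∧' (ψ ⇒ φ)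

zero' : ∀ {n} → Term n
zero' = app Z []

suc' : ∀ {n} → Term n → Term n
suc' t = app S (t ∷ [])

Ren : ℕ → ℕ → Set
Ren m n = Fin m → Fin n

extR : ∀ {m n} → Ren m n → Ren (suc m) (suc n)
extR ρ zero    = zero
extR ρ (suc i) = suc (ρ i)

mutual
  renT : ∀ {m n} → Ren m n → Term m → Term n
  renT ρ (var i)    = var (ρ i)
  renT ρ (app f ts) = app f (renTs ρ ts)

  renTs : ∀ {m n k} → Ren m n → Vec (Term m) k → Vec (Term n) k
  renTs ρ []       = []
  renTs ρ (t ∷ ts) = renT ρ t ∷ renTs ρ ts

renF : ∀ {m n} → Ren m n → Formula m → Formula n
renF ρ (t ≐ s)  = renT ρ t ≐ renT ρ s
renF ρ ⊥'       = ⊥'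
renF ρ (φ ∧' ψ) = renF ρ φ ∧' renF ρ ψ
renF ρ (φ ∨' ψ) = renF ρ φ ∨' renF ρ ψ
renF ρ (φ ⇒ ψ)  = renF ρ φ ⇒ renF ρ ψ
renF ρ (∀' φ)   = ∀' (renF (extR ρ) φ)
renF ρ (∃' φ)   = ∃' (renF (extR ρ) φ)

wk : ∀ {n} → Formula n → Formula (suc n)
wk = renF suc

Sub : ℕ → ℕ → Set
Sub m n = Fin m → Term n

extS : ∀ {m n} → Sub m n → Sub (suc m) (suc n)
extS σ zero    = var zero
extS σ (suc i) = renT suc (σ i)

mutual
  subT : ∀ {m n} → Sub m n → Term m → Term n
  subT σ (var i)    = σ i
  subT σ (app f ts) = app f (subTs σ ts)

  subTs : ∀ {m n k} → Sub m n → Vec (Term m) k → Vec (Term n) k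
  subTs σ []       = []
  subTs σ (t ∷ ts) = subT σ t ∷ subTs σ ts

subF : ∀ {m n} → Sub m n → Formula m → Formula n
subF σ (t ≐ s)  = subT σ t ≐ subT σ s
subF σ ⊥'       = ⊥'
subF σ (φ ∧' ψ) = subF σ φ ∧' subF σ ψ
subF σ (φ ∨' ψ) = subF σ φ ∨' subF σ ψ
subF σ (φ ⇒ ψ)  = subF σ φ ⇒ subF σ ψ
subF σ (∀' φ)   = ∀' (subF (extS σ) φ)
subF σ (∃' φ)   = ∃' (subF (extS σ) φ)

sub0 : ∀ {n} → Term n → Sub (suc n) n
sub0 t zero    = t
sub0 t (suc i) = var i

_[_≔0] : ∀ {n} → Formula (suc n) → Term n → Formula n
φ [ t ≔0] = subF (sub0 t) φ

close : (n : ℕ) → Formula n → Formula 0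
close zero    φ = φ
close (suc n) φ = close n (∀' φ)

emb : ∀ {n} → Formula 0 → Formula n
emb = renF (λ ())

mutual
  data FreeT {n : ℕ} (x : Fin n) : Term n → Set where
    fv-var : FreeT x (var x)
    fv-app : ∀ {m} {f : PR m} {ts} → FreeTs x ts → FreeT x (app f ts)

  data FreeTs {n : ℕ} (x : Fin n) : ∀ {k} → Vec (Term n) k → Set where
    here  : ∀ {k t} {ts : Vec (Term n) k} → FreeT x t → FreeTs x (t ∷ ts)
    there : ∀ {k t} {ts : Vec (Term n) k} → FreeTs x ts → FreeTs x (t ∷ ts)

data FreeF : ∀ {n} → Fin n → Formula n → Set where
  fv-≐ˡ : ∀ {n x} {t s : Term n} → FreeT x t → FreeF x (t ≐ s)
  fv-≐ʳ : ∀ {n x} {t s : Term n} → FreeT x s → FreeF x (t ≐ s)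
  fv-∧ˡ : ∀ {n x} {φ ψ : Formula n} → FreeF x φ → FreeF x (φ ∧' ψ)
  fv-∧ʳ : ∀ {n x} {φ ψ : Formula n} → FreeF x ψ → FreeF x (φ ∧' ψ)
  fv-∨ˡ : ∀ {n x} {φ ψ : Formula n} → FreeF x φ → FreeF x (φ ∨' ψ)
  fv-∨ʳ : ∀ {n x} {φ ψ : Formula n} → FreeF x ψ → FreeF x (φ ∨' ψ)
  fv-⇒ˡ : ∀ {n x} {φ ψ : Formula n} → FreeF x φ → FreeF x (φ ⇒ ψ)
  fv-⇒ʳ : ∀ {n x} {φ ψ : Formula n} → FreeF x ψ → FreeF x (φ ⇒ ψ)
  fv-∀  : ∀ {n x} {φ : Formula (suc n)} → FreeF (suc x) φ → FreeF x (∀' φ)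
  fv-∃  : ∀ {n x} {φ : Formula (suc n)} → FreeF (suc x) φ → FreeF x (∃' φ)

SameFV : ∀ {n} → Formula n → Formula n → Set
SameFV φ ψ = ∀ x → (FreeF x φ → FreeF x ψ) × (FreeF x ψ → FreeF x φ)

Theory : Set₁
Theory = Formula 0 → Set

data Der (T : Theory) : ∀ {n} → List (Formula n) → Formula n → Set where
  hyp  : ∀ {n Γ} {φ : Formula n} → φ ∈ Γ → Der T Γ φ
  ax   : ∀ {n} {Γ : List (Formula n)} {φ} → T φ → Der T Γ (emb φ)
  ⊥E   : ∀ {n Γ} {φ : Formula n} → Der T Γ ⊥' → Der T Γ φ
  ∧I   : ∀ {n Γ} {φ ψ : Formula n} → Der T Γ φ → Der T Γ ψ → Der T Γ (φ ∧' ψ)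
  ∧E₁  : ∀ {n Γ} {φ ψ : Formula n} → Der T Γ (φ ∧' ψ) → Der T Γ φ
  ∧E₂  : ∀ {n Γ} {φ ψ : Formula n} → Der T Γ (φ ∧' ψ) → Der T Γ ψ
  ∨I₁  : ∀ {n Γ} {φ ψ : Formula n} → Der T Γ φ → Der T Γ (φ ∨' ψ)
  ∨I₂  : ∀ {n Γ} {φ ψ : Formula n} → Der T Γ ψ → Der T Γ (φ ∨' ψ)
  ∨E   : ∀ {n Γ} {φ ψ χ : Formula n} → Der T Γ (φ ∨' ψ) →
         Der T (φ ∷ Γ) χ → Der T (ψ ∷ Γ) χ → Der T Γ χ
  ⇒I   : ∀ {n Γ} {φ ψ : Formula n} → Der T (φ ∷ Γ) ψ → Der T Γ (φ ⇒ ψ)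
  ⇒E   : ∀ {n Γ} {φ ψ : Formula n} → Der T Γ (φ ⇒ ψ) → Der T Γ φ → Der T Γ ψ
  ∀I   : ∀ {n Γ} {φ : Formula (suc n)} → Der T (map wk Γ) φ → Der T Γ (∀' φ)
  ∀E   : ∀ {n Γ} {φ : Formula (suc n)} → Der T Γ (∀' φ) → (t : Term n) → Der T Γ (φ [ t ≔0])
  ∃I   : ∀ {n Γ} {φ : Formula (suc n)} (t : Term n) → Der T Γ (φ [ t ≔0]) → Der T Γ (∃' φ)
  ∃E   : ∀ {n Γ} {φ : Formula (suc n)} {ψ : Formula n} → Der T Γ (∃' φ) →
         Der T (φ ∷ map wk Γ) (wk ψ) → Der T Γ ψ

_⊢_ : Theory → ∀ {n} → Formula n → Set
T ⊢ φ = Der T [] φ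

Extends : Theory → Theory → Set
Extends T T₀ = ∀ (φ : Formula 0) → T₀ ⊢ φ → T ⊢ φ

-- Arithmetic hierarchy (prenex classes; blocks may be empty)

data QF : ∀ {n} → Formula n → Set where
  qf-≐ : ∀ {n} {t s : Term n} → QF (t ≐ s)
  qf-⊥ : ∀ {n} → QF {n} ⊥'
  qf-∧ : ∀ {n} {φ ψ : Formula n} → QF φ → QF ψ → QF (φ ∧' ψ)
  qf-∨ : ∀ {n} {φ ψ : Formula n} → QF φ → QF ψ → QF (φ ∨' ψ)
  qf-⇒ : ∀ {n} {φ ψ : Formula n} → QF φ → QF ψ → QF (φ ⇒ ψ)

mutual
  data IsΣ : ℕ → ∀ {n} → Formula n → Set where
    Σ-qf  : ∀ {n} {φ : Formula n} → QF φ → IsΣ 0 φ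
    Σ-blk : ∀ {k n} {φ : Formula n} → IsΠ k φ → IsΣ (suc k) φ
    Σ-∃   : ∀ {k n} {φ : Formula (suc n)} → IsΣ (suc k) φ → IsΣ (suc k) (∃' φ)

  data IsΠ : ℕ → ∀ {n} → Formula n → Set where
    Π-qf  : ∀ {n} {φ : Formula n} → QF φ → IsΠ 0 φ
    Π-blk : ∀ {k n} {φ : Formula n} → IsΣ k φ → IsΠ (suc k) φ
    Π-∀   : ∀ {k n} {φ : Formula (suc n)} → IsΠ (suc k) φ → IsΠ (suc k) (∀' φ)

vars : (n : ℕ) → Vec (Term n) n
vars n = tabulate var

data HA-ax : Theory where
  ax-S≠0 : HA-ax (∀' (¬' (suc' (var zero) ≐ zero')))
  ax-Sinj : HA-ax (∀' (∀' ((suc' (var (suc zero)) ≐ suc' (var zero)) ⇒ (var (suc zero) ≐ var zero))))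
  ax-refl : HA-ax (∀' (var zero ≐ var zero))
  ax-leib : ∀ {n} (φ : Formula (suc n)) →
    HA-ax (close (suc (suc n))
      ((var (suc zero) ≐ var zero) ⇒
        subF (λ { zero → var (suc zero) ; (suc i) → var (suc (suc i)) }) φ ⇒
        subF (λ { zero → var zero ; (suc i) → var (suc (suc i)) }) φ))
  ax-P : ∀ {n} (i : Fin n) → HA-ax (close n (app (P i) (vars n) ≐ var i))
  ax-C : ∀ {m n} (f : PR m) (gs : Vec (PR n) m) →
    HA-ax (close n (app (C f gs) (vars n) ≐ app f (Data.Vec.map (λ g → app g (vars n)) gs)))
  ax-R0 : ∀ {n} (f : PR n) (g : PR (suc (suc n))) →
    HA-ax (close n (app (R f g) (zero' ∷ vars n) ≐ app f (vars n)))
  ax-RS : ∀ {n} (f : PR n) (g : PR (suc (suc n))) →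
    HA-ax (close (suc n)
      (app (R f g) (suc' (var zero) ∷ Data.Vec.map (renT suc) (vars n)) ≐
       app g (var zero ∷ app (R f g) (var zero ∷ Data.Vec.map (renT suc) (vars n))
                        ∷ Data.Vec.map (renT suc) (vars n))))
  ax-ind : ∀ {n} (φ : Formula (suc n)) →
    HA-ax (close n ((φ [ zero' ≔0] ∧'
      ∀' (φ ⇒ subF (λ { zero → suc' (var zero) ; (suc i) → var (suc i) }) φ)) ⇒ ∀' φ))

data NNDNE (j : ℕ) : Theory where
  nndne : ∀ {n} (φ : Formula n) → IsΣ j φ → NNDNE j (¬' (¬' (close n (¬' (¬' φ) ⇒ φ))))

-- HA + ¬¬DNE(Σ_{k-1})   (just HA if k = 0)
data HA+ : ℕ → Theory where
  ha   : ∀ {k φ} → HA-ax φ → HA+ k φ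
  dne  : ∀ {j φ} → NNDNE j φ → HA+ (suc j) φ

data Sign : Set where
  plus minus : Sign

Path : Set
Path = List Sign

swap : Sign → Sign
swap plus  = minus
swap minus = plus

_^⊥ : Path → Path
s ^⊥ = map swap s

-- i(s); nothing stands for ×
init : Path → Maybe Sign
init []      = nothing
init (q ∷ _) = just q

prep : Sign → Path → Path
prep plus  (plus ∷ s)  = plus ∷ s
prep minus (minus ∷ s) = minus ∷ s
prep q     s           = q ∷ s

Alt : ∀ {n} → Formula n → List Path
Alt (t ≐ s)  = [ [] ]
Alt ⊥'       = [ [] ]
Alt (φ ∧' ψ) = Alt φ ++ Alt ψ
Alt (φ ∨' ψ) = Alt φ ++ Alt ψ
Alt (φ ⇒ ψ)  = map _^⊥ (Alt φ) ++ Alt ψ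
Alt (∀' φ)   = map (prep minus) (Alt φ)
Alt (∃' φ)   = map (prep plus) (Alt φ)

deg : ∀ {n} → Formula n → ℕ
deg φ = foldr _⊔_ 0 (map length (Alt φ))

F : ℕ → ∀ {n} → Formula n → Set
F k φ = deg φ ≡ k

E : ℕ → ∀ {n} → Formula n → Set
E zero    φ = F 0 φ
E (suc k) φ = F (suc k) φ × (∀ s → s ∈ Alt φ → length s ≡ suc k → init s ≡ just plus)

Class : Set₁
Class = ∀ {n} → Formula n → Set

NegC : Class → Class
NegC Γ {n} φ = Σ (Formula n) λ ψ → (φ ≡ ¬' ψ) × Γ ψ

NegNegC : Class → Class
NegNegC Γ {n} φ = Σ (Formula n) λ ψ → (φ ≡ ¬' (¬' ψ)) × Γ ψ

PNFT : Theory → Class → Class → Set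
PNFT T Γ Γ' = ∀ {n} (φ : Formula n) → Γ φ →
  Σ (Formula n) λ φ' → Γ' φ' × SameFV φ φ' × (T ⊢ (φ ⇔ φ'))

-- Take ψ ∈ E_k'. By hypothesis ψ is equivalent to some ψ' ∈ Σ_k', and ¬ψ is equivalent
-- to ¬¬χ as soon as ¬ψ' is equivalent to some χ ∈ Π_k' (because ¬ψ ↔ ¬¬¬ψ').  Such a χ is
-- found by recursion on the prenex structure of ψ': ¬∃x φ ↔ ∀x ¬φ pushes the negation
-- through existential blocks, and a negated universal formula ¬∀x̄ φ ∈ ¬Π_m has only
-- alternation paths of length ≤ m, all starting with +, so it lies in E_d for some d ≤ m
-- and the hypothesis turns it into a Σ_d formula.
module Submission where

open import Defs
open import Data.Nat using (ℕ; _≤_; zero; suc; z≤n; s≤s; _≤′_; ≤′-refl; ≤′-step)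
open import Data.Nat.Properties using (≤-refl; ≤-trans; n≤1+n; ⊔-lub; ≤⇒≤′)
open import Data.Fin using (zero; suc)
open import Data.Vec using (Vec; []; _∷_)
open import Data.List using (List; []; _∷_; map; length)
open import Data.List.Properties using (length-map; foldr-preservesᵇ)
open import Data.List.Relation.Unary.All using (tabulate)
open import Data.List.Relation.Unary.All.Properties using (map⁺)
open import Data.List.Relation.Unary.Any using (here; there)
open import Data.List.Membership.Propositional using (_∈_)
open import Data.List.Membership.Propositional.Properties using (∈-map⁻; ∈-map⁺; ∈-++⁻)
open import Data.Maybe using (just)
open import Data.Product using (Σ; ∃-syntax; _×_; _,_; proj₁; proj₂)
open import Data.Sum using (_⊎_; inj₁; inj₂)
open import Relation.Binary.PropositionalEquality using (_≡_; refl; sym; cong; cong₂; subst)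


mutual
  subT-renT-inverse : ∀ {m n} (ρ : Ren m n) (σ : Sub n m) → (∀ i → σ (ρ i) ≡ var i) →
                      (t : Term m) → subT σ (renT ρ t) ≡ t
  subT-renT-inverse ρ σ σρ≡var (var i)    = σρ≡var i
  subT-renT-inverse ρ σ σρ≡var (app f ts) = cong (app f) (subTs-renTs-inverse ρ σ σρ≡var ts)

  subTs-renTs-inverse : ∀ {m n k} (ρ : Ren m n) (σ : Sub n m) → (∀ i → σ (ρ i) ≡ var i) →
                        (ts : Vec (Term m) k) → subTs σ (renTs ρ ts) ≡ ts
  subTs-renTs-inverse ρ σ σρ≡var []       = refl
  subTs-renTs-inverse ρ σ σρ≡var (t ∷ ts) =
    cong₂ _∷_ (subT-renT-inverse ρ σ σρ≡var t) (subTs-renTs-inverse ρ σ σρ≡var ts)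

extS-extR-inverse : ∀ {m n} (ρ : Ren m n) (σ : Sub n m) → (∀ i → σ (ρ i) ≡ var i) →
                    ∀ i → extS σ (extR ρ i) ≡ var i
extS-extR-inverse ρ σ σρ≡var zero    = refl
extS-extR-inverse ρ σ σρ≡var (suc i) = cong (renT suc) (σρ≡var i)

subF-renF-inverse : ∀ {m n} (ρ : Ren m n) (σ : Sub n m) → (∀ i → σ (ρ i) ≡ var i) →
                    (φ : Formula m) → subF σ (renF ρ φ) ≡ φ
subF-renF-inverse ρ σ σρ≡var (t ≐ s)  = cong₂ _≐_ (subT-renT-inverse ρ σ σρ≡var t) (subT-renT-inverse ρ σ σρ≡var s)
subF-renF-inverse ρ σ σρ≡var ⊥'       = refl
subF-renF-inverse ρ σ σρ≡var (φ ∧' ψ) = cong₂ _∧'_ (subF-renF-inverse ρ σ σρ≡var φ) (subF-renF-inverse ρ σ σρ≡var ψ)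
subF-renF-inverse ρ σ σρ≡var (φ ∨' ψ) = cong₂ _∨'_ (subF-renF-inverse ρ σ σρ≡var φ) (subF-renF-inverse ρ σ σρ≡var ψ)
subF-renF-inverse ρ σ σρ≡var (φ ⇒ ψ)  = cong₂ _⇒_ (subF-renF-inverse ρ σ σρ≡var φ) (subF-renF-inverse ρ σ σρ≡var ψ)
subF-renF-inverse ρ σ σρ≡var (∀' φ)   = cong ∀' (subF-renF-inverse (extR ρ) (extS σ) (extS-extR-inverse ρ σ σρ≡var) φ)
subF-renF-inverse ρ σ σρ≡var (∃' φ)   = cong ∃' (subF-renF-inverse (extR ρ) (extS σ) (extS-extR-inverse ρ σ σρ≡var) φ)

wk-body-var₀ : ∀ {n} (φ : Formula (suc n)) → renF (extR suc) φ [ var zero ≔0] ≡ φ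
wk-body-var₀ = subF-renF-inverse (extR suc) (sub0 (var zero)) λ { zero → refl ; (suc i) → refl }


_⊆_ : ∀ {n} → List (Formula n) → List (Formula n) → Set
Γ ⊆ Δ = ∀ {φ} → φ ∈ Γ → φ ∈ Δ

∷-⊆ : ∀ {n} {Γ Δ : List (Formula n)} {φ} → Γ ⊆ Δ → (φ ∷ Γ) ⊆ (φ ∷ Δ)
∷-⊆ Γ⊆Δ (here p)  = here p
∷-⊆ Γ⊆Δ (there p) = there (Γ⊆Δ p)

map-wk-⊆ : ∀ {n} {Γ Δ : List (Formula n)} → Γ ⊆ Δ → map wk Γ ⊆ map wk Δ
map-wk-⊆ Γ⊆Δ p with ∈-map⁻ wk p
... | _ , φ∈Γ , refl = ∈-map⁺ wk (Γ⊆Δ φ∈Γ)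

Der-mono : ∀ {T n} {Γ Δ : List (Formula n)} {φ} → Γ ⊆ Δ → Der T Γ φ → Der T Δ φ
Der-mono Γ⊆Δ (hyp p)       = hyp (Γ⊆Δ p)
Der-mono Γ⊆Δ (ax p)        = ax p
Der-mono Γ⊆Δ (⊥E d)        = ⊥E (Der-mono Γ⊆Δ d)
Der-mono Γ⊆Δ (∧I d e)      = ∧I (Der-mono Γ⊆Δ d) (Der-mono Γ⊆Δ e)
Der-mono Γ⊆Δ (∧E₁ d)       = ∧E₁ (Der-mono Γ⊆Δ d)
Der-mono Γ⊆Δ (∧E₂ d)       = ∧E₂ (Der-mono Γ⊆Δ d)
Der-mono Γ⊆Δ (∨I₁ d)       = ∨I₁ (Der-mono Γ⊆Δ d)
Der-mono Γ⊆Δ (∨I₂ d)       = ∨I₂ (Der-mono Γ⊆Δ d)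
Der-mono Γ⊆Δ (∨E d e f)    = ∨E (Der-mono Γ⊆Δ d) (Der-mono (∷-⊆ Γ⊆Δ) e) (Der-mono (∷-⊆ Γ⊆Δ) f)
Der-mono Γ⊆Δ (⇒I d)        = ⇒I (Der-mono (∷-⊆ Γ⊆Δ) d)
Der-mono Γ⊆Δ (⇒E d e)      = ⇒E (Der-mono Γ⊆Δ d) (Der-mono Γ⊆Δ e)
Der-mono Γ⊆Δ (∀I d)        = ∀I (Der-mono (map-wk-⊆ Γ⊆Δ) d)
Der-mono Γ⊆Δ (∀E d t)      = ∀E (Der-mono Γ⊆Δ d) t
Der-mono Γ⊆Δ (∃I t d)      = ∃I t (Der-mono Γ⊆Δ d)
Der-mono Γ⊆Δ (∃E d e)      = ∃E (Der-mono Γ⊆Δ d) (Der-mono (∷-⊆ (map-wk-⊆ Γ⊆Δ)) e)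

weaken : ∀ {T n} {Γ : List (Formula n)} {φ} → T ⊢ φ → Der T Γ φ
weaken = Der-mono (λ ())

hyp₀ : ∀ {T n} {Γ : List (Formula n)} {φ} → Der T (φ ∷ Γ) φ
hyp₀ = hyp (here refl)

hyp₁ : ∀ {T n} {Γ : List (Formula n)} {φ ψ} → Der T (ψ ∷ φ ∷ Γ) φ
hyp₁ = hyp (there (here refl))

hyp₂ : ∀ {T n} {Γ : List (Formula n)} {φ ψ χ} → Der T (χ ∷ ψ ∷ φ ∷ Γ) φ
hyp₂ = hyp (there (there (here refl)))

module _ {T : Theory} {n : ℕ} where

  ⇔-refl : (φ : Formula n) → T ⊢ (φ ⇔ φ)
  ⇔-refl φ = ∧I (⇒I hyp₀) (⇒I hyp₀)

  ⇔-sym : {φ ψ : Formula n} → T ⊢ (φ ⇔ ψ) → T ⊢ (ψ ⇔ φ)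
  ⇔-sym d = ∧I (∧E₂ d) (∧E₁ d)

  ⇒-trans : {φ ψ χ : Formula n} → T ⊢ (φ ⇒ ψ) → T ⊢ (ψ ⇒ χ) → T ⊢ (φ ⇒ χ)
  ⇒-trans d e = ⇒I (⇒E (weaken e) (⇒E (weaken d) hyp₀))

  ⇔-trans : {φ ψ χ : Formula n} → T ⊢ (φ ⇔ ψ) → T ⊢ (ψ ⇔ χ) → T ⊢ (φ ⇔ χ)
  ⇔-trans d e = ∧I (⇒-trans (∧E₁ d) (∧E₁ e)) (⇒-trans (∧E₂ e) (∧E₂ d))

  contraposition : {φ ψ : Formula n} → T ⊢ (φ ⇒ ψ) → T ⊢ (¬' ψ ⇒ ¬' φ)
  contraposition d = ⇒I (⇒I (⇒E hyp₁ (⇒E (weaken d) hyp₀)))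

  ¬-cong : {φ ψ : Formula n} → T ⊢ (φ ⇔ ψ) → T ⊢ (¬' φ ⇔ ¬' ψ)
  ¬-cong d = ∧I (contraposition (∧E₂ d)) (contraposition (∧E₁ d))

  ¬¬¬⇔¬ : (φ : Formula n) → T ⊢ (¬' (¬' (¬' φ)) ⇔ ¬' φ)
  ¬¬¬⇔¬ φ = ∧I (⇒I (⇒I (⇒E hyp₁ (⇒I (⇒E hyp₀ hyp₁))))) (⇒I (⇒I (⇒E hyp₀ hyp₁)))

  ∀-mono : {φ ψ : Formula (suc n)} → T ⊢ (φ ⇒ ψ) → T ⊢ (∀' φ ⇒ ∀' ψ)
  ∀-mono {φ} d = ⇒I (∀I (⇒E (weaken d) (subst (Der T _) (wk-body-var₀ φ) (∀E hyp₀ (var zero)))))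

  ∀-cong : {φ ψ : Formula (suc n)} → T ⊢ (φ ⇔ ψ) → T ⊢ (∀' φ ⇔ ∀' ψ)
  ∀-cong d = ∧I (∀-mono (∧E₁ d)) (∀-mono (∧E₂ d))

  ¬∃⇔∀¬ : (φ : Formula (suc n)) → T ⊢ (¬' (∃' φ) ⇔ ∀' (¬' φ))
  ¬∃⇔∀¬ φ =
    ∧I (⇒I (∀I (⇒I (⇒E hyp₁ (∃I (var zero) (subst (Der T _) (sym (wk-body-var₀ φ)) hyp₀))))))
       (⇒I (⇒I (∃E hyp₀ (⇒E (subst (Der T _) (wk-body-var₀ (¬' φ)) (∀E hyp₂ (var zero))) hyp₀))))


module _ {n : ℕ} where

  SameFV-refl : (φ : Formula n) → SameFV φ φ
  SameFV-refl φ x = (λ p → p) , (λ p → p)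

  SameFV-sym : {φ ψ : Formula n} → SameFV φ ψ → SameFV ψ φ
  SameFV-sym φ~ψ x = proj₂ (φ~ψ x) , proj₁ (φ~ψ x)

  SameFV-trans : {φ ψ χ : Formula n} → SameFV φ ψ → SameFV ψ χ → SameFV φ χ
  SameFV-trans φ~ψ ψ~χ x = (λ p → proj₁ (ψ~χ x) (proj₁ (φ~ψ x) p)) , (λ p → proj₂ (φ~ψ x) (proj₂ (ψ~χ x) p))

  SameFV-¬ : (φ : Formula n) → SameFV φ (¬' φ)
  SameFV-¬ φ x = fv-⇒ˡ , λ { (fv-⇒ˡ p) → p ; (fv-⇒ʳ ()) }

  SameFV-¬-cong : {φ ψ : Formula n} → SameFV φ ψ → SameFV (¬' φ) (¬' ψ)
  SameFV-¬-cong {φ} {ψ} φ~ψ = SameFV-trans (SameFV-sym (SameFV-¬ φ)) (SameFV-trans φ~ψ (SameFV-¬ ψ))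

  SameFV-¬∃-∀ : {φ χ : Formula (suc n)} → SameFV (¬' φ) χ → SameFV (¬' (∃' φ)) (∀' χ)
  SameFV-¬∃-∀ {φ} {χ} ¬φ~χ x = to , from
    where
    to : FreeF x (¬' (∃' φ)) → FreeF x (∀' χ)
    to (fv-⇒ˡ (fv-∃ p)) = fv-∀ (proj₁ (¬φ~χ (suc x)) (fv-⇒ˡ p))
    to (fv-⇒ʳ ())
    from : FreeF x (∀' χ) → FreeF x (¬' (∃' φ))
    from (fv-∀ p) with proj₂ (¬φ~χ (suc x)) p
    ... | fv-⇒ˡ q = fv-⇒ˡ (fv-∃ q)


mutual
  QF⇒IsΣ : ∀ {m n} {φ : Formula n} → QF φ → IsΣ m φ
  QF⇒IsΣ {zero}  q = Σ-qf q
  QF⇒IsΣ {suc m} q = Σ-blk (QF⇒IsΠ q)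

  QF⇒IsΠ : ∀ {m n} {φ : Formula n} → QF φ → IsΠ m φ
  QF⇒IsΠ {zero}  q = Π-qf q
  QF⇒IsΠ {suc m} q = Π-blk (QF⇒IsΣ q)

mutual
  IsΣ-suc : ∀ {m n} {φ : Formula n} → IsΣ m φ → IsΣ (suc m) φ
  IsΣ-suc (Σ-qf q)  = QF⇒IsΣ q
  IsΣ-suc (Σ-blk p) = Σ-blk (IsΠ-suc p)
  IsΣ-suc (Σ-∃ p)   = Σ-∃ (IsΣ-suc p)

  IsΠ-suc : ∀ {m n} {φ : Formula n} → IsΠ m φ → IsΠ (suc m) φ
  IsΠ-suc (Π-qf q)  = QF⇒IsΠ q
  IsΠ-suc (Π-blk p) = Π-blk (IsΣ-suc p)
  IsΠ-suc (Π-∀ p)   = Π-∀ (IsΠ-suc p)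

IsΣ-mono′ : ∀ {a b n} {φ : Formula n} → a ≤′ b → IsΣ a φ → IsΣ b φ
IsΣ-mono′ ≤′-refl        p = p
IsΣ-mono′ (≤′-step a≤′b) p = IsΣ-suc (IsΣ-mono′ a≤′b p)

IsΣ-mono : ∀ {a b n} {φ : Formula n} → a ≤ b → IsΣ a φ → IsΣ b φ
IsΣ-mono a≤b = IsΣ-mono′ (≤⇒≤′ a≤b)


prep-length-≤ : ∀ q (s : Path) → length (prep q s) ≤ suc (length s)
prep-length-≤ plus  []          = ≤-refl
prep-length-≤ plus  (plus ∷ s)  = n≤1+n _
prep-length-≤ plus  (minus ∷ s) = ≤-refl
prep-length-≤ minus []          = ≤-refl
prep-length-≤ minus (plus ∷ s)  = ≤-refl
prep-length-≤ minus (minus ∷ s) = n≤1+n _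

prep-length-≥ : ∀ q (s : Path) → length s ≤ length (prep q s)
prep-length-≥ plus  []          = z≤n
prep-length-≥ plus  (plus ∷ s)  = ≤-refl
prep-length-≥ plus  (minus ∷ s) = n≤1+n _
prep-length-≥ minus []          = z≤n
prep-length-≥ minus (plus ∷ s)  = n≤1+n _
prep-length-≥ minus (minus ∷ s) = ≤-refl

prep-idem : ∀ q (s : Path) → prep q (prep q s) ≡ prep q s
prep-idem plus  []          = refl
prep-idem plus  (plus ∷ s)  = refl
prep-idem plus  (minus ∷ s) = refl
prep-idem minus []          = refl
prep-idem minus (plus ∷ s)  = refl
prep-idem minus (minus ∷ s) = refl

init-prep-minus-^⊥ : ∀ (s : Path) → init (prep minus s ^⊥) ≡ just plus
init-prep-minus-^⊥ []          = refl
init-prep-minus-^⊥ (plus ∷ s)  = refl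
init-prep-minus-^⊥ (minus ∷ s) = refl

Alt-QF : ∀ {n} {φ : Formula n} → QF φ → ∀ {s} → s ∈ Alt φ → s ≡ []
Alt-QF qf-≐ (here p) = p
Alt-QF qf-⊥ (here p) = p
Alt-QF (qf-∧ {φ = φ} q r) s∈ with ∈-++⁻ (Alt φ) s∈
... | inj₁ s∈φ = Alt-QF q s∈φ
... | inj₂ s∈ψ = Alt-QF r s∈ψ
Alt-QF (qf-∨ {φ = φ} q r) s∈ with ∈-++⁻ (Alt φ) s∈
... | inj₁ s∈φ = Alt-QF q s∈φ
... | inj₂ s∈ψ = Alt-QF r s∈ψ
Alt-QF (qf-⇒ {φ = φ} q r) s∈ with ∈-++⁻ (map _^⊥ (Alt φ)) s∈
... | inj₂ s∈ψ = Alt-QF r s∈ψ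
... | inj₁ s∈φ⊥ with ∈-map⁻ _^⊥ s∈φ⊥
... | t , t∈φ , refl rewrite Alt-QF q t∈φ = refl

-- A nonempty path of a Σ_m formula stays within length m even after prefixing +
-- (dually for Π_m and -); this is the invariant that survives the block rules.
mutual
  Alt-Σ : ∀ {m n} {φ : Formula n} → IsΣ m φ → ∀ {s} → s ∈ Alt φ → s ≡ [] ⊎ length (prep plus s) ≤ m
  Alt-Σ (Σ-qf q) s∈ = inj₁ (Alt-QF q s∈)
  Alt-Σ (Σ-blk p) {s} s∈ with Alt-Π p s∈
  ... | inj₁ s≡[] = inj₁ s≡[]
  ... | inj₂ ≤m   = inj₂ (≤-trans (prep-length-≤ plus s) (s≤s (≤-trans (prep-length-≥ minus s) ≤m)))
  Alt-Σ (Σ-∃ p) s∈ with ∈-map⁻ (prep plus) s∈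
  ... | t , t∈ , refl rewrite prep-idem plus t with Alt-Σ p t∈
  ... | inj₁ refl = inj₂ (s≤s z≤n)
  ... | inj₂ ≤m   = inj₂ ≤m

  Alt-Π : ∀ {m n} {φ : Formula n} → IsΠ m φ → ∀ {s} → s ∈ Alt φ → s ≡ [] ⊎ length (prep minus s) ≤ m
  Alt-Π (Π-qf q) s∈ = inj₁ (Alt-QF q s∈)
  Alt-Π (Π-blk p) {s} s∈ with Alt-Σ p s∈
  ... | inj₁ s≡[] = inj₁ s≡[]
  ... | inj₂ ≤m   = inj₂ (≤-trans (prep-length-≤ minus s) (s≤s (≤-trans (prep-length-≥ plus s) ≤m)))
  Alt-Π (Π-∀ p) s∈ with ∈-map⁻ (prep minus) s∈
  ... | t , t∈ , refl rewrite prep-idem minus t with Alt-Π p t∈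
  ... | inj₁ refl = inj₂ (s≤s z≤n)
  ... | inj₂ ≤m   = inj₂ ≤m

Alt-Π-length : ∀ {m n} {φ : Formula n} → IsΠ m φ → ∀ {s} → s ∈ Alt φ → length s ≤ m
Alt-Π-length p {s} s∈ with Alt-Π p s∈
... | inj₁ refl = z≤n
... | inj₂ ≤m   = ≤-trans (prep-length-≥ minus s) ≤m

Alt-¬ : ∀ {n} (φ : Formula n) {s} → s ∈ Alt (¬' φ) → s ≡ [] ⊎ ∃[ t ] t ∈ Alt φ × s ≡ t ^⊥
Alt-¬ φ s∈ with ∈-++⁻ (map _^⊥ (Alt φ)) s∈
... | inj₂ (here s≡[]) = inj₁ s≡[]
... | inj₁ s∈φ⊥        = inj₂ (∈-map⁻ _^⊥ s∈φ⊥)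

deg-≤ : ∀ {m n} (φ : Formula n) → (∀ {s} → s ∈ Alt φ → length s ≤ m) → deg φ ≤ m
deg-≤ {m} φ bound = foldr-preservesᵇ {P = _≤ m} ⊔-lub z≤n (map⁺ (tabulate bound))

deg-¬-≤ : ∀ {m n} (φ : Formula n) → (∀ {s} → s ∈ Alt φ → length s ≤ m) → deg (¬' φ) ≤ m
deg-¬-≤ φ bound = deg-≤ (¬' φ) λ s∈ → case (Alt-¬ φ s∈)
  where
  case : ∀ {s} → s ≡ [] ⊎ ∃[ t ] t ∈ Alt φ × s ≡ t ^⊥ → length s ≤ _
  case (inj₁ refl)              = z≤n
  case (inj₂ (t , t∈ , refl)) rewrite length-map swap t = bound t∈

Positive : Path → Set
Positive s = s ≡ [] ⊎ init s ≡ just plus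

positive⇒E : ∀ {n} (φ : Formula n) {d} → deg φ ≡ d → (∀ {s} → s ∈ Alt φ → Positive s) → E d φ
positive⇒E φ {zero}  deg≡ positive = deg≡
positive⇒E φ {suc d} deg≡ positive = deg≡ , λ s s∈ len → maximal-positive s len (positive s∈)
  where
  maximal-positive : ∀ s → length s ≡ suc d → Positive s → init s ≡ just plus
  maximal-positive .[] () (inj₁ refl)
  maximal-positive s   _  (inj₂ p)    = p

Alt-¬∀-positive : ∀ {n} (φ : Formula (suc n)) {s} → s ∈ Alt (¬' (∀' φ)) → Positive s
Alt-¬∀-positive φ s∈ with Alt-¬ (∀' φ) s∈
... | inj₁ s≡[] = inj₁ s≡[]
... | inj₂ (t , t∈ , refl) with ∈-map⁻ (prep minus) t∈
... | u , _ , refl = inj₂ (init-prep-minus-^⊥ u)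


HasNormalForm : Theory → Class → ∀ {n} → Formula n → Set
HasNormalForm T Γ {n} φ = Σ (Formula n) λ φ' → Γ φ' × SameFV φ φ' × (T ⊢ (φ ⇔ φ'))

HasNormalForm-mono : ∀ {T : Theory} {Γ Δ : Class} {n} {φ : Formula n} →
                     (∀ {n} {χ : Formula n} → Γ χ → Δ χ) → HasNormalForm T Γ φ → HasNormalForm T Δ φ
HasNormalForm-mono Γ⊆Δ (φ' , φ'∈Γ , fv , d) = φ' , Γ⊆Δ φ'∈Γ , fv , d

module NegatedNormalForms (k : ℕ) (T : Theory)
  (pnft-E : ∀ k' → k' ≤ k → PNFT T (E k') (IsΣ k')) where

  ¬∀-normal-form : ∀ {m n} {φ : Formula (suc n)} → m ≤ k → IsΠ m (∀' φ) →
                   HasNormalForm T (IsΣ m) (¬' (∀' φ))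
  ¬∀-normal-form {φ = φ} m≤k p =
    HasNormalForm-mono {Γ = IsΣ _} {Δ = IsΣ _} (IsΣ-mono deg≤m) (pnft-E _ (≤-trans deg≤m m≤k) (¬' (∀' φ)) ¬∀φ∈E)
    where
    deg≤m : deg (¬' (∀' φ)) ≤ _
    deg≤m = deg-¬-≤ (∀' φ) (Alt-Π-length p)
    ¬∀φ∈E : E (deg (¬' (∀' φ))) (¬' (∀' φ))
    ¬∀φ∈E = positive⇒E (¬' (∀' φ)) refl (Alt-¬∀-positive φ)

  mutual
    ¬Σ-normal-form : ∀ {m n} {φ : Formula n} → m ≤ k → IsΣ m φ → HasNormalForm T (IsΠ m) (¬' φ)
    ¬Σ-normal-form m≤k (Σ-qf {φ = φ} q) = ¬' φ , Π-qf (qf-⇒ q qf-⊥) , SameFV-refl _ , ⇔-refl _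
    ¬Σ-normal-form m≤k (Σ-blk p) = HasNormalForm-mono {Γ = IsΣ _} {Δ = IsΠ _} Π-blk (¬Π-normal-form (≤-trans (n≤1+n _) m≤k) p)
    ¬Σ-normal-form m≤k (Σ-∃ {φ = φ} p) with ¬Σ-normal-form m≤k p
    ... | χ , χ∈Π , fv , d = ∀' χ , Π-∀ χ∈Π , SameFV-¬∃-∀ fv , ⇔-trans (¬∃⇔∀¬ φ) (∀-cong d)

    ¬Π-normal-form : ∀ {m n} {φ : Formula n} → m ≤ k → IsΠ m φ → HasNormalForm T (IsΣ m) (¬' φ)
    ¬Π-normal-form m≤k (Π-qf {φ = φ} q) = ¬' φ , Σ-qf (qf-⇒ q qf-⊥) , SameFV-refl _ , ⇔-refl _
    ¬Π-normal-form m≤k (Π-blk p) = HasNormalForm-mono {Γ = IsΠ _} {Δ = IsΣ _} Σ-blk (¬Σ-normal-form (≤-trans (n≤1+n _) m≤k) p)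
    ¬Π-normal-form m≤k (Π-∀ p) = ¬∀-normal-form m≤k (Π-∀ p)

¬-normal-form : ∀ {T : Theory} {Γ Δ : Class} {n} {ψ : Formula n} →
                (h : HasNormalForm T Γ ψ) → HasNormalForm T Δ (¬' (proj₁ h)) →
                HasNormalForm T (NegNegC Δ) (¬' ψ)
¬-normal-form (ψ' , _ , fv₁ , d₁) (χ , χ∈Δ , fv₂ , d₂) =
  ¬' (¬' χ) , (χ , refl , χ∈Δ) ,
  SameFV-trans (SameFV-¬-cong fv₁) (SameFV-trans fv₂ (SameFV-trans (SameFV-¬ χ) (SameFV-¬ (¬' χ)))) ,
  ⇔-trans (¬-cong d₁) (⇔-trans (⇔-sym (¬¬¬⇔¬ ψ')) (¬-cong (¬-cong d₂)))

lemma7p11 : (k : ℕ) (T : Theory) → Extends T (HA+ k) →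
    (∀ k' → k' ≤ k → PNFT T (E k') (IsΣ k')) →
    ∀ k' → k' ≤ k → PNFT T (NegC (E k')) (NegNegC (IsΠ k'))
lemma7p11 k T _ pnft-E k' k'≤k .(¬' ψ) (ψ , refl , ψ∈E) =
  ¬-normal-form {Γ = IsΣ k'} {Δ = IsΠ k'} ψ-form (¬Σ-normal-form k'≤k (proj₁ (proj₂ ψ-form)))
  where
  open NegatedNormalForms k T pnft-E
  ψ-form : HasNormalForm T (IsΣ k') ψ
  ψ-form = pnft-E k' k'≤k ψ ψ∈E
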